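{- Let $a>b>0$ be integers with $a\le 2b$. Then a $\mathrm{LC}(a^2b^2)$ exists.
   Context: A latin cube of order $N$ is an $N\times N\times N$ array on $N$ symbols such that any two cells whose coordinates differ in exactly one position contain different symbols; a subcube is an $m\times m\times m$ subarray (indices in each coordinate from chosen $m$-sets) that is itself a latin cube of order $m$; subcubes are disjoint if they share no index in any coordinate and no symbol. $\mathrm{LC}(a^2b^2)$ denotes a latin cube of order $2a+2b$ with pairwise disjoint subcubes of orders $a,a,b,b$. -}

module Defs where

open import Data.Nat using (ℕ; _+_; _*_)
open import Data.Fin using (Fin)
open import Data.Product using (Σ; ∃; _×_; _,_)
open import Relation.Binary.PropositionalEquality using (_≡_; _≢_)
open import Relation.Nullary using (¬_)
open import Function.Definitions using (Injective)

Cube : ℕ → Set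
Cube N = Fin N → Fin N → Fin N → Fin N

record IsLatinCube {N : ℕ} (L : Cube N) : Set where
  field
    line₁ : ∀ {x x'} y z → x ≢ x' → L x y z ≢ L x' y z
    line₂ : ∀ x {y y'} z → y ≢ y' → L x y z ≢ L x y' z
    line₃ : ∀ x y {z z'} → z ≢ z' → L x y z ≢ L x y z'

-- A subcube of order m of L: three m-sets of indices (given as injective maps
-- Fin m → Fin N, one per coordinate) together with an m-set of symbols
-- (injective map Fin m → Fin N), such that the m×m×m subarray is a latin cube
-- of order m on these m symbols.  'entry' gives the symbol (as an index into
-- the symbol m-set) appearing in each cell of the subarray, and the subarray
-- is latin in this re-indexed form.
record Subcube {N : ℕ} (L : Cube N) (m : ℕ) : Set where
  field
    row₁ row₂ row₃ sym : Fin m → Fin N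
    row₁-inj : Injective _≡_ _≡_ row₁
    row₂-inj : Injective _≡_ _≡_ row₂
    row₃-inj : Injective _≡_ _≡_ row₃
    sym-inj  : Injective _≡_ _≡_ sym
    entry    : Fin m → Fin m → Fin m → Fin m
    entry-ok : ∀ i j k → L (row₁ i) (row₂ j) (row₃ k) ≡ sym (entry i j k)
    entry-latin : IsLatinCube entry

DisjointImg : {m n N : ℕ} → (Fin m → Fin N) → (Fin n → Fin N) → Set
DisjointImg f g = ∀ i j → f i ≢ g j

Disjoint : {N m n : ℕ} {L : Cube N} → Subcube L m → Subcube L n → Set
Disjoint A B =
  DisjointImg (Subcube.row₁ A) (Subcube.row₁ B) ×
  DisjointImg (Subcube.row₂ A) (Subcube.row₂ B) ×
  DisjointImg (Subcube.row₃ A) (Subcube.row₃ B) ×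
  DisjointImg (Subcube.sym A) (Subcube.sym B)

LC-a²b² : ℕ → ℕ → Set
LC-a²b² a b =
  Σ (Cube (2 * a + 2 * b)) λ L → IsLatinCube L ×
  Σ (Subcube L a) λ A₁ → Σ (Subcube L a) λ A₂ →
  Σ (Subcube L b) λ B₁ → Σ (Subcube L b) λ B₂ →
  Disjoint A₁ A₂ × Disjoint A₁ B₁ × Disjoint A₁ B₂ ×
  Disjoint A₂ B₁ × Disjoint A₂ B₂ × Disjoint B₁ B₂

-- Take a latin square S of order 2a + 2b whose diagonal blocks of orders a, a, b, b
-- are subsquares (not necessarily on disjoint symbol sets).  The cube L(x, y, z) := the
-- w with S(z, w) = S(x, y) is latin, and a subsquare on the index set P yields a
-- subcube with P as index set in every coordinate and as symbol set, so the four
-- blocks give pairwise disjoint subcubes.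
--
-- S is obtained by prolonging Z₂ × Z_a, with its Z₂-coordinate suitably twisted, by
-- 2b: each line gets 2b chosen cells (the a cells of its diagonal block and
-- 2b − a ≤ a cells of the other block) which receive new symbols, their old
-- symbols move to the border, and the border is completed by Z₂ × Z_b.  The
-- diagonal blocks then carry only new symbols.  In border column ℓ the old symbol
-- coming from row x = (i, u) is (tag, 2u + σ(i) + t(i, ℓ)), and dually for border
-- rows.  For odd a (σ = 0) the tag determines i and doubling is injective modulo a;
-- for even a (σ(i) = i ∈ {0, 1}) the twist makes the tag record which half of Z_a
-- contains u, and then 2u + i modulo a determines u and i.

module Submission where

open import Defs
open import Data.Bool using (Bool; true; false; not; _xor_; if_then_else_; T)
open import Data.Bool.Properties using (not-injective; xor-same; xor-comm; xor-identityʳ; xor-inverseʳ)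
open import Data.Empty using (⊥-elim)
open import Data.Fin as Fin using (Fin; toℕ; fromℕ<; punchOut)
open import Data.Fin.Properties using (any?; punchOut-injective; injective⇒≤; toℕ-fromℕ<; toℕ-injective; toℕ<n)
open import Data.Nat using (ℕ; zero; suc; _+_; _*_; _∸_; _<_; _≤_; _<ᵇ_; _<?_; NonZero; _%_; _/_; s≤s; z≤n; >-nonZero; >-nonZero⁻¹)
open import Data.Nat.Properties
open import Data.Nat.DivMod using (m%n<n; m<n⇒m%n≡m; m%n%n≡m%n; [m+kn]%n≡m%n; %-distribˡ-+; %-distribˡ-*; m≡m%n+[m/n]*n)
open import Data.Nat.Tactic.RingSolver using (solve-∀)
open import Data.Product using (∃-syntax; _×_; _,_; proj₁; proj₂)
open import Data.Sum using (_⊎_; inj₁; inj₂)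
open import Data.Unit using (tt)
open import Function using (flip)
open import Function.Definitions using (Injective)
open import Relation.Binary.PropositionalEquality
open import Relation.Nullary using (yes; no)

injective⇒onto : ∀ {n} (f : Fin n → Fin n) → Injective _≡_ _≡_ f → ∀ y → ∃[ x ] f x ≡ y
injective⇒onto {zero}  f f-injective ()
injective⇒onto {suc n} f f-injective y with any? (λ x → f x Fin.≟ y)
... | yes hit  = hit
... | no  miss = ⊥-elim (<-irrefl refl (injective⇒≤ g-injective))
  where
  y≢f : ∀ x → y ≢ f x
  y≢f x y≡fx = miss (x , sym y≡fx)
  g : Fin (suc n) → Fin n
  g x = punchOut (y≢f x)
  g-injective : Injective _≡_ _≡_ g
  g-injective {x} {x'} eq = f-injective (punchOut-injective (y≢f x) (y≢f x') eq)

module SquareToCube {n : ℕ} (S : Fin n → Fin n → Fin n)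
  (S-cancelˡ : ∀ x → Injective _≡_ _≡_ (S x))
  (S-cancelʳ : ∀ y → Injective _≡_ _≡_ (flip S y)) where

  cube : Cube n
  cube x y z = proj₁ (injective⇒onto (S z) (S-cancelˡ z) (S x y))

  cube-spec : ∀ x y z → S z (cube x y z) ≡ S x y
  cube-spec x y z = proj₂ (injective⇒onto (S z) (S-cancelˡ z) (S x y))

  cube-reflects : ∀ {x y x' y'} z → cube x y z ≡ cube x' y' z → S x y ≡ S x' y'
  cube-reflects {x} {y} {x'} {y'} z eq =
    trans (sym (cube-spec x y z)) (trans (cong (S z) eq) (cube-spec x' y' z))

  cube-latin : IsLatinCube cube
  cube-latin = record
    { line₁ = λ y z x≢x' eq → x≢x' (S-cancelʳ y (cube-reflects z eq))
    ; line₂ = λ x z y≢y' eq → y≢y' (S-cancelˡ x (cube-reflects z eq))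
    ; line₃ = λ x y z≢z' eq → z≢z' (S-cancelʳ _ (layers-agree x y eq))
    }
    where
    layers-agree : ∀ x y {z z'} → cube x y z ≡ cube x y z' → S z (cube x y z') ≡ S z' (cube x y z')
    layers-agree x y {z} {z'} eq =
      trans (cong (S z) (sym eq)) (trans (cube-spec x y z) (sym (cube-spec x y z')))

subsquare⇒subcube : ∀ {n m} (S : Fin n → Fin n → Fin n)
  (S-cancelˡ : ∀ x → Injective _≡_ _≡_ (S x)) (S-cancelʳ : ∀ y → Injective _≡_ _≡_ (flip S y))
  (p : Fin m → Fin n) → Injective _≡_ _≡_ p →
  (g : Fin m → Fin n) (M : Fin m → Fin m → Fin m) → (∀ i j → S (p i) (p j) ≡ g (M i j)) →
  Subcube (SquareToCube.cube S S-cancelˡ S-cancelʳ) m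
subsquare⇒subcube S S-cancelˡ S-cancelʳ p p-injective g M S≡gM = record
  { row₁ = p ; row₂ = p ; row₃ = p ; sym = p
  ; row₁-inj = p-injective ; row₂-inj = p-injective ; row₃-inj = p-injective ; sym-inj = p-injective
  ; entry = C.cube
  ; entry-ok = λ i j k → S-cancelˡ (p k) (trans (L.cube-spec (p i) (p j) (p k)) (sym (S-agrees i j k)))
  ; entry-latin = C.cube-latin
  }
  where
  M-reflects : ∀ {i j i' j'} → M i j ≡ M i' j' → S (p i) (p j) ≡ S (p i') (p j')
  M-reflects {i} {j} {i'} {j'} eq = trans (S≡gM i j) (trans (cong g eq) (sym (S≡gM i' j')))
  M-cancelˡ : ∀ i → Injective _≡_ _≡_ (M i)
  M-cancelˡ i eq = p-injective (S-cancelˡ (p i) (M-reflects eq))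
  M-cancelʳ : ∀ j → Injective _≡_ _≡_ (flip M j)
  M-cancelʳ j eq = p-injective (S-cancelʳ (p j) (M-reflects eq))
  module L = SquareToCube S S-cancelˡ S-cancelʳ
  module C = SquareToCube M M-cancelˡ M-cancelʳ
  S-agrees : ∀ i j k → S (p k) (p (C.cube i j k)) ≡ S (p i) (p j)
  S-agrees i j k = M-reflects (C.cube-spec i j k)

record IsLatinSquare (n : ℕ) (S : ℕ → ℕ → ℕ) : Set where
  field
    closed  : ∀ {x y} → x < n → y < n → S x y < n
    cancelˡ : ∀ {x y y'} → x < n → y < n → y' < n → S x y ≡ S x y' → y ≡ y'
    cancelʳ : ∀ {y x x'} → y < n → x < n → x' < n → S x y ≡ S x' y → x ≡ x'

transpose-latin : ∀ {n S} → IsLatinSquare n S → IsLatinSquare n (flip S)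
transpose-latin L = record
  { closed = λ x<n y<n → closed y<n x<n ; cancelˡ = cancelʳ ; cancelʳ = cancelˡ }
  where open IsLatinSquare L

IsSubsquareAt : (ℕ → ℕ → ℕ) → ℕ → ℕ → Set
IsSubsquareAt S o m = ∀ {x y} → x < m → y < m → S (o + x) (o + y) < m

module LatinSquareToCube {N : ℕ} {S : ℕ → ℕ → ℕ} (L : IsLatinSquare N S) where
  open IsLatinSquare L

  Sᶠ : Fin N → Fin N → Fin N
  Sᶠ x y = fromℕ< (closed (toℕ<n x) (toℕ<n y))

  toℕ-Sᶠ : ∀ x y → toℕ (Sᶠ x y) ≡ S (toℕ x) (toℕ y)
  toℕ-Sᶠ x y = toℕ-fromℕ< _

  Sᶠ-reflects : ∀ {x y x' y'} → Sᶠ x y ≡ Sᶠ x' y' → S (toℕ x) (toℕ y) ≡ S (toℕ x') (toℕ y')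
  Sᶠ-reflects {x} {y} {x'} {y'} eq = trans (sym (toℕ-Sᶠ x y)) (trans (cong toℕ eq) (toℕ-Sᶠ x' y'))

  Sᶠ-cancelˡ : ∀ x → Injective _≡_ _≡_ (Sᶠ x)
  Sᶠ-cancelˡ x {y} {y'} eq = toℕ-injective (cancelˡ (toℕ<n x) (toℕ<n y) (toℕ<n y') (Sᶠ-reflects eq))

  Sᶠ-cancelʳ : ∀ y → Injective _≡_ _≡_ (flip Sᶠ y)
  Sᶠ-cancelʳ y {x} {x'} eq = toℕ-injective (cancelʳ (toℕ<n y) (toℕ<n x) (toℕ<n x') (Sᶠ-reflects eq))

  open SquareToCube Sᶠ Sᶠ-cancelˡ Sᶠ-cancelʳ public using (cube; cube-latin)

  shift : ∀ o {m} → o + m ≤ N → Fin m → Fin N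
  shift o o+m≤N i = fromℕ< (<-≤-trans (+-monoʳ-< o (toℕ<n i)) o+m≤N)

  toℕ-shift : ∀ o {m} (o+m≤N : o + m ≤ N) i → toℕ (shift o o+m≤N i) ≡ o + toℕ i
  toℕ-shift o o+m≤N i = toℕ-fromℕ< _

  shift-injective : ∀ o {m} (o+m≤N : o + m ≤ N) → Injective _≡_ _≡_ (shift o o+m≤N)
  shift-injective o o+m≤N {i} {j} eq = toℕ-injective (+-cancelˡ-≡ o _ _
    (trans (sym (toℕ-shift o o+m≤N i)) (trans (cong toℕ eq) (toℕ-shift o o+m≤N j))))

  blockSubcube : ∀ o {m} → o + m ≤ N → IsSubsquareAt S o m → Subcube cube m
  blockSubcube o {m} o+m≤N block =
    subsquare⇒subcube Sᶠ Sᶠ-cancelˡ Sᶠ-cancelʳ (shift o o+m≤N) (shift-injective o o+m≤N) (shift 0 m≤N) M S≡gM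
    where
    m≤N : 0 + m ≤ N
    m≤N = ≤-trans (m≤n+m m o) o+m≤N
    M : Fin m → Fin m → Fin m
    M i j = fromℕ< (block (toℕ<n i) (toℕ<n j))
    S≡gM : ∀ i j → Sᶠ (shift o o+m≤N i) (shift o o+m≤N j) ≡ shift 0 m≤N (M i j)
    S≡gM i j = toℕ-injective (begin
      toℕ (Sᶠ (shift o o+m≤N i) (shift o o+m≤N j)) ≡⟨ toℕ-Sᶠ _ _ ⟩
      S (toℕ (shift o o+m≤N i)) (toℕ (shift o o+m≤N j)) ≡⟨ cong₂ S (toℕ-shift o o+m≤N i) (toℕ-shift o o+m≤N j) ⟩
      S (o + toℕ i) (o + toℕ j)                         ≡⟨ toℕ-fromℕ< _ ⟨
      toℕ (M i j)                                        ≡⟨ toℕ-shift 0 m≤N (M i j) ⟨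
      toℕ (shift 0 m≤N (M i j))                          ∎)
      where open ≡-Reasoning

  shifts-disjoint : ∀ o₁ o₂ {m₁ m₂} (le₁ : o₁ + m₁ ≤ N) (le₂ : o₂ + m₂ ≤ N) → o₁ + m₁ ≤ o₂ →
                    DisjointImg (shift o₁ le₁) (shift o₂ le₂)
  shifts-disjoint o₁ o₂ le₁ le₂ o₁+m₁≤o₂ i j eq = <⇒≱ (<-≤-trans (+-monoʳ-< o₁ (toℕ<n i)) o₁+m₁≤o₂)
    (≤-trans (m≤m+n o₂ (toℕ j))
      (≤-reflexive (trans (sym (toℕ-shift o₂ le₂ j)) (trans (cong toℕ (sym eq)) (toℕ-shift o₁ le₁ i)))))

  blockSubcubes-disjoint : ∀ o₁ o₂ {m₁ m₂} (le₁ : o₁ + m₁ ≤ N) (le₂ : o₂ + m₂ ≤ N)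
    (block₁ : IsSubsquareAt S o₁ m₁) (block₂ : IsSubsquareAt S o₂ m₂) → o₁ + m₁ ≤ o₂ →
    Disjoint (blockSubcube o₁ le₁ block₁) (blockSubcube o₂ le₂ block₂)
  blockSubcubes-disjoint o₁ o₂ le₁ le₂ _ _ o₁+m₁≤o₂ = apart , apart , apart , apart
    where
    apart : DisjointImg (shift o₁ le₁) (shift o₂ le₂)
    apart = shifts-disjoint o₁ o₂ le₁ le₂ o₁+m₁≤o₂

latinSquare⇒LC-a²b² : ∀ {a b S} → IsLatinSquare (2 * a + 2 * b) S →
  IsSubsquareAt S 0 a → IsSubsquareAt S a a → IsSubsquareAt S (2 * a) b → IsSubsquareAt S (2 * a + b) b →
  LC-a²b² a b
latinSquare⇒LC-a²b² {a} {b} {S} L A₁ A₂ B₁ B₂ =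
  cube , cube-latin , sub A₁ end₁ , sub A₂ end₂ , sub B₁ end₃ , sub B₂ end₄ ,
  disjoint A₁ A₂ end₁ end₂ ≤-refl ,
  disjoint A₁ B₁ end₁ end₃ a≤2a ,
  disjoint A₁ B₂ end₁ end₄ (≤-trans a≤2a 2a≤2a+b) ,
  disjoint A₂ B₁ end₂ end₃ a+a≤2a ,
  disjoint A₂ B₂ end₂ end₄ (≤-trans a+a≤2a 2a≤2a+b) ,
  disjoint B₁ B₂ end₃ end₄ ≤-refl
  where
  open LatinSquareToCube L
  N : ℕ
  N = 2 * a + 2 * b
  a+a≤2a : a + a ≤ 2 * a
  a+a≤2a = ≤-reflexive (cong (a +_) (sym (+-identityʳ a)))
  a≤2a : a ≤ 2 * a
  a≤2a = ≤-trans (m≤m+n a a) a+a≤2a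
  2a≤2a+b : 2 * a ≤ 2 * a + b
  2a≤2a+b = m≤m+n (2 * a) b
  end₄ : 2 * a + b + b ≤ N
  end₄ = ≤-reflexive (trans (+-assoc (2 * a) b b) (cong (λ t → 2 * a + (b + t)) (sym (+-identityʳ b))))
  end₃ : 2 * a + b ≤ N
  end₃ = ≤-trans (m≤m+n (2 * a + b) b) end₄
  end₂ : a + a ≤ N
  end₂ = ≤-trans (≤-trans a+a≤2a 2a≤2a+b) end₃
  end₁ : 0 + a ≤ N
  end₁ = ≤-trans (m≤m+n a a) end₂
  sub : ∀ {o m} → IsSubsquareAt S o m → o + m ≤ N → Subcube cube m
  sub {o} block le = blockSubcube o le block
  disjoint : ∀ {o₁ o₂ m₁ m₂} (block₁ : IsSubsquareAt S o₁ m₁) (block₂ : IsSubsquareAt S o₂ m₂)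
             (le₁ : o₁ + m₁ ≤ N) (le₂ : o₂ + m₂ ≤ N) → o₁ + m₁ ≤ o₂ → Disjoint (sub block₁ le₁) (sub block₂ le₂)
  disjoint {o₁} {o₂} block₁ block₂ le₁ le₂ = blockSubcubes-disjoint o₁ o₂ le₁ le₂ block₁ block₂

<⇒<ᵇ≡true : ∀ {x m} → x < m → (x <ᵇ m) ≡ true
<⇒<ᵇ≡true {x} {m} x<m with x <ᵇ m in eq
... | true  = refl
... | false = ⊥-elim (subst T eq (<⇒<ᵇ x<m))

<ᵇ≡true⇒< : ∀ {x m} → (x <ᵇ m) ≡ true → x < m
<ᵇ≡true⇒< {x} {m} eq = <ᵇ⇒< x m (subst T (sym eq) tt)

≥⇒<ᵇ≡false : ∀ {x m} → m ≤ x → (x <ᵇ m) ≡ false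
≥⇒<ᵇ≡false {x} {m} m≤x with x <ᵇ m in eq
... | false = refl
... | true  = ⊥-elim (<⇒≱ (<ᵇ≡true⇒< eq) m≤x)

<ᵇ≡false⇒≥ : ∀ {x m} → (x <ᵇ m) ≡ false → m ≤ x
<ᵇ≡false⇒≥ eq = ≮⇒≥ (λ x<m → subst T eq (<⇒<ᵇ x<m))

-- Prolonging a latin square of order m by k: in each row x the chosen cells
-- column x c (c < k) get new symbols [0, k) and their old symbols move to the
-- border column m + c; dually for columns.  Old symbols s are renamed k + s.
record Prolongation (m k : ℕ) : Set where
  field
    base       : ℕ → ℕ → ℕ
    base-latin : IsLatinSquare m base
    chosen     : ℕ → ℕ → Bool
    new        : ℕ → ℕ → ℕ
    new-<      : ∀ {x y} → x < m → y < m → chosen x y ≡ true → new x y < k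
    new-cancelˡ : ∀ {x y y'} → x < m → y < m → y' < m →
                  chosen x y ≡ true → chosen x y' ≡ true → new x y ≡ new x y' → y ≡ y'
    new-cancelʳ : ∀ {y x x'} → y < m → x < m → x' < m →
                  chosen x y ≡ true → chosen x' y ≡ true → new x y ≡ new x' y → x ≡ x'
    column           : ℕ → ℕ → ℕ
    column-<         : ∀ {x c} → x < m → c < k → column x c < m
    column-chosen    : ∀ {x c} → x < m → c < k → chosen x (column x c) ≡ true
    column-injective : ∀ {x c c'} → x < m → c < k → c' < k → column x c ≡ column x c' → c ≡ c'
    column-transversal : ∀ {c x x'} → c < k → x < m → x' < m →
                         base x (column x c) ≡ base x' (column x' c) → x ≡ x'
    row           : ℕ → ℕ → ℕ
    row-<         : ∀ {y r} → y < m → r < k → row y r < m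
    row-chosen    : ∀ {y r} → y < m → r < k → chosen (row y r) y ≡ true
    row-injective : ∀ {y r r'} → y < m → r < k → r' < k → row y r ≡ row y r' → r ≡ r'
    row-transversal : ∀ {r y y'} → r < k → y < m → y' < m →
                      base (row y r) y ≡ base (row y' r) y' → y ≡ y'

transpose : ∀ {m k} → Prolongation m k → Prolongation m k
transpose P = record
  { base = flip base ; base-latin = transpose-latin base-latin
  ; chosen = flip chosen ; new = flip new
  ; new-< = λ x<m y<m → new-< y<m x<m ; new-cancelˡ = new-cancelʳ ; new-cancelʳ = new-cancelˡ
  ; column = row ; column-< = row-< ; column-chosen = row-chosen
  ; column-injective = row-injective ; column-transversal = row-transversal
  ; row = column ; row-< = column-< ; row-chosen = column-chosen
  ; row-injective = column-injective ; row-transversal = column-transversal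
  }
  where open Prolongation P

module Prolong {m k : ℕ} (P : Prolongation m k) (corner : ℕ → ℕ → ℕ) (corner-latin : IsLatinSquare k corner) where
  open Prolongation P

  mainCell : ℕ → ℕ → Bool → ℕ
  mainCell x y true  = new x y
  mainCell x y false = k + base x y

  cell : Bool → Bool → ℕ → ℕ → ℕ
  cell true  true  x y = mainCell x y (chosen x y)
  cell true  false x y = k + base x (column x (y ∸ m))
  cell false true  x y = k + base (row y (x ∸ m)) y
  cell false false x y = corner (x ∸ m) (y ∸ m)

  square : ℕ → ℕ → ℕ
  square x y = cell (x <ᵇ m) (y <ᵇ m) x y

  data Position : ℕ → Set where
    main   : ∀ {x} → x < m → Position x
    border : ∀ c → Position (m + c)

  position : ∀ x → Position x
  position x with x <? m
  ... | yes x<m = main x<m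
  ... | no  x≮m = subst Position (m+[n∸m]≡n (≮⇒≥ x≮m)) (border (x ∸ m))

  border-< : ∀ {c} → m + c < m + k → c < k
  border-< = +-cancelˡ-< m _ _

  square-main : ∀ {x y} → x < m → y < m → square x y ≡ mainCell x y (chosen x y)
  square-main x<m y<m rewrite <⇒<ᵇ≡true x<m | <⇒<ᵇ≡true y<m = refl

  square-right : ∀ {x} → x < m → ∀ c → square x (m + c) ≡ k + base x (column x c)
  square-right {x} x<m c rewrite <⇒<ᵇ≡true x<m | ≥⇒<ᵇ≡false (m≤m+n m c) | m+n∸m≡n m c = refl

  square-below : ∀ r {y} → y < m → square (m + r) y ≡ k + base (row y r) y
  square-below r y<m rewrite ≥⇒<ᵇ≡false (m≤m+n m r) | <⇒<ᵇ≡true y<m | m+n∸m≡n m r = refl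

  square-corner : ∀ r c → square (m + r) (m + c) ≡ corner r c
  square-corner r c rewrite ≥⇒<ᵇ≡false (m≤m+n m r) | ≥⇒<ᵇ≡false (m≤m+n m c)
                          | m+n∸m≡n m r | m+n∸m≡n m c = refl

  new≢old : ∀ {u} z → u < k → u ≢ k + z
  new≢old z u<k eq = <⇒≱ u<k (subst (k ≤_) (sym eq) (m≤m+n k z))

  old-<m+k : ∀ {z} → z < m → k + z < m + k
  old-<m+k {z} z<m = subst (k + z <_) (+-comm k m) (+-monoʳ-< k z<m)

  <k⇒<m+k : ∀ {z} → z < k → z < m + k
  <k⇒<m+k z<k = <-≤-trans z<k (m≤n+m k m)

  open IsLatinSquare base-latin using () renaming (closed to base-closed; cancelˡ to base-cancelˡ)
  open IsLatinSquare corner-latin using () renaming (closed to corner-closed; cancelˡ to corner-cancelˡ)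

  mainCell-< : ∀ {x y} → x < m → y < m → mainCell x y (chosen x y) < m + k
  mainCell-< {x} {y} x<m y<m with chosen x y in is-chosen
  ... | true  = <k⇒<m+k (new-< x<m y<m is-chosen)
  ... | false = old-<m+k (base-closed x<m y<m)

  square-closed : ∀ {x y} → x < m + k → y < m + k → square x y < m + k
  square-closed {x} {y} x<n y<n with position x | position y
  ... | main x<m | main y<m = subst (_< m + k) (sym (square-main x<m y<m)) (mainCell-< x<m y<m)
  ... | main x<m | border c = subst (_< m + k) (sym (square-right x<m c))
                                (old-<m+k (base-closed x<m (column-< x<m (border-< y<n))))
  ... | border r | main y<m = subst (_< m + k) (sym (square-below r y<m))
                                (old-<m+k (base-closed (row-< y<m (border-< x<n)) y<m))
  ... | border r | border c = subst (_< m + k) (sym (square-corner r c))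
                                (<k⇒<m+k (corner-closed (border-< x<n) (border-< y<n)))

  mainCell-cancelˡ : ∀ {x y y'} → x < m → y < m → y' < m →
                     mainCell x y (chosen x y) ≡ mainCell x y' (chosen x y') → y ≡ y'
  mainCell-cancelˡ {x} {y} {y'} x<m y<m y'<m eq with chosen x y in cy | chosen x y' in cy'
  ... | true  | true  = new-cancelˡ x<m y<m y'<m cy cy' eq
  ... | true  | false = ⊥-elim (new≢old _ (new-< x<m y<m cy) eq)
  ... | false | true  = ⊥-elim (new≢old _ (new-< x<m y'<m cy') (sym eq))
  ... | false | false = base-cancelˡ x<m y<m y'<m (+-cancelˡ-≡ k _ _ eq)

  -- Displaced symbols come from chosen cells, so they differ from those kept by unchosen ones.
  mainCell≢displaced : ∀ {x y c} → x < m → y < m → c < k →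
                       mainCell x y (chosen x y) ≢ k + base x (column x c)
  mainCell≢displaced {x} {y} {c} x<m y<m c<k eq with chosen x y in cy
  ... | true  = new≢old _ (new-< x<m y<m cy) eq
  ... | false with base-cancelˡ x<m y<m (column-< x<m c<k) (+-cancelˡ-≡ k _ _ eq)
  ...   | refl with () ← trans (sym cy) (column-chosen x<m c<k)

  square-cancelˡ : ∀ {x y y'} → x < m + k → y < m + k → y' < m + k → square x y ≡ square x y' → y ≡ y'
  square-cancelˡ {x} {y} {y'} x<n y<n y'<n eq with position x | position y | position y'
  ... | main x<m | main y<m | main y'<m =
    mainCell-cancelˡ x<m y<m y'<m (trans (sym (square-main x<m y<m)) (trans eq (square-main x<m y'<m)))
  ... | main x<m | main y<m | border c' = ⊥-elim (mainCell≢displaced x<m y<m (border-< y'<n)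
    (trans (sym (square-main x<m y<m)) (trans eq (square-right x<m c'))))
  ... | main x<m | border c | main y'<m = ⊥-elim (mainCell≢displaced x<m y'<m (border-< y<n)
    (trans (sym (square-main x<m y'<m)) (trans (sym eq) (square-right x<m c))))
  ... | main x<m | border c | border c' = cong (m +_) (column-injective x<m (border-< y<n) (border-< y'<n)
    (base-cancelˡ x<m (column-< x<m (border-< y<n)) (column-< x<m (border-< y'<n))
      (+-cancelˡ-≡ k _ _ (trans (sym (square-right x<m c)) (trans eq (square-right x<m c'))))))
  ... | border r | main y<m | main y'<m = row-transversal (border-< x<n) y<m y'<m
    (+-cancelˡ-≡ k _ _ (trans (sym (square-below r y<m)) (trans eq (square-below r y'<m))))
  ... | border r | main y<m | border c' = ⊥-elim (new≢old _ (corner-closed (border-< x<n) (border-< y'<n))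
    (trans (sym (square-corner r c')) (trans (sym eq) (square-below r y<m))))
  ... | border r | border c | main y'<m = ⊥-elim (new≢old _ (corner-closed (border-< x<n) (border-< y<n))
    (trans (sym (square-corner r c)) (trans eq (square-below r y'<m))))
  ... | border r | border c | border c' = cong (m +_) (corner-cancelˡ (border-< x<n) (border-< y<n) (border-< y'<n)
    (trans (sym (square-corner r c)) (trans eq (square-corner r c'))))

square-transpose : ∀ {m k} (P : Prolongation m k) corner corner-latin x y →
  Prolong.square (transpose P) (flip corner) (transpose-latin corner-latin) x y ≡ Prolong.square P corner corner-latin y x
square-transpose {m} P corner corner-latin x y = cellᵀ (x <ᵇ m) (y <ᵇ m)
  where
  open Prolongation P using (chosen)
  module Pᵀ = Prolong (transpose P) (flip corner) (transpose-latin corner-latin)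
  module P = Prolong P corner corner-latin
  cellᵀ : ∀ i j → Pᵀ.cell i j x y ≡ P.cell j i y x
  cellᵀ true  true  with chosen y x
  ... | true  = refl
  ... | false = refl
  cellᵀ true  false = refl
  cellᵀ false true  = refl
  cellᵀ false false = refl

prolongation-latin : ∀ {m k} (P : Prolongation m k) corner (corner-latin : IsLatinSquare k corner) →
                     IsLatinSquare (m + k) (Prolong.square P corner corner-latin)
prolongation-latin P corner corner-latin = record
  { closed  = P.square-closed
  ; cancelˡ = P.square-cancelˡ
  ; cancelʳ = λ y<n x<n x'<n eq → Pᵀ.square-cancelˡ y<n x<n x'<n
      (trans (square-transpose P corner corner-latin _ _) (trans eq (sym (square-transpose P corner corner-latin _ _))))
  }
  where
  module P = Prolong P corner corner-latin
  module Pᵀ = Prolong (transpose P) (flip corner) (transpose-latin corner-latin)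

xor-cancelˡ : ∀ i {j j'} → i xor j ≡ i xor j' → j ≡ j'
xor-cancelˡ false eq = eq
xor-cancelˡ true  eq = not-injective eq

xor-cancelʳ : ∀ i {j j'} → j xor i ≡ j' xor i → j ≡ j'
xor-cancelʳ i {j} {j'} eq = xor-cancelˡ i (trans (xor-comm i j) (trans eq (xor-comm j' i)))

module Modular (a : ℕ) .{{_ : NonZero a}} where

  infix 4 _≈_
  _≈_ : ℕ → ℕ → Set
  x ≈ y = x % a ≡ y % a

  ≈-+ˡ : ∀ z {x y} → x ≈ y → z + x ≈ z + y
  ≈-+ˡ z {x} {y} x≈y = begin
    (z + x) % a           ≡⟨ %-distribˡ-+ z x a ⟩
    (z % a + x % a) % a   ≡⟨ cong (λ t → (z % a + t) % a) x≈y ⟩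
    (z % a + y % a) % a   ≡⟨ %-distribˡ-+ z y a ⟨
    (z + y) % a           ∎
    where open ≡-Reasoning

  ≈-+ʳ : ∀ z {x y} → x ≈ y → x + z ≈ y + z
  ≈-+ʳ z {x} {y} x≈y = trans (cong (_% a) (+-comm x z)) (trans (≈-+ˡ z x≈y) (cong (_% a) (+-comm z y)))

  ≈-*ˡ : ∀ z {x y} → x ≈ y → z * x ≈ z * y
  ≈-*ˡ z {x} {y} x≈y = begin
    (z * x) % a           ≡⟨ %-distribˡ-* z x a ⟩
    (z % a * (x % a)) % a ≡⟨ cong (λ t → (z % a * t) % a) x≈y ⟩
    (z % a * (y % a)) % a ≡⟨ %-distribˡ-* z y a ⟨
    (z * y) % a           ∎
    where open ≡-Reasoning

  %-≈ : ∀ x → x % a ≈ x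
  %-≈ x = m%n%n≡m%n x a

  +-multiple-≈ : ∀ x q → x + q * a ≈ x
  +-multiple-≈ x q = [m+kn]%n≡m%n x q a

  ≈⇒≡ : ∀ {x y} → x < a → y < a → x ≈ y → x ≡ y
  ≈⇒≡ x<a y<a x≈y = trans (sym (m<n⇒m%n≡m x<a)) (trans x≈y (m<n⇒m%n≡m y<a))

  -- The additive inverse of z modulo a, represented in (0, a].
  neg : ℕ → ℕ
  neg z = a ∸ z % a

  +-neg : ∀ z x → z + x + neg z ≈ x
  +-neg z x = trans (cong (_% a) z+x+neg≡) (+-multiple-≈ x (1 + z / a))
    where
    rearrange : ∀ r q x n → r + q + x + n ≡ x + (r + n) + q
    rearrange = solve-∀
    collect : ∀ x a q → x + a + q * a ≡ x + (1 + q) * a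
    collect = solve-∀
    z+x+neg≡ : z + x + neg z ≡ x + (1 + z / a) * a
    z+x+neg≡ = begin
      z + x + neg z                           ≡⟨ cong (λ t → t + x + neg z) (m≡m%n+[m/n]*n z a) ⟩
      z % a + z / a * a + x + neg z           ≡⟨ rearrange (z % a) (z / a * a) x (neg z) ⟩
      x + (z % a + neg z) + z / a * a         ≡⟨ cong (λ t → x + t + z / a * a) (m+[n∸m]≡n (<⇒≤ (m%n<n z a))) ⟩
      x + a + z / a * a                       ≡⟨ collect x a (z / a) ⟩
      x + (1 + z / a) * a                     ∎
      where open ≡-Reasoning

  ≈-cancelˡ : ∀ z {x y} → z + x ≈ z + y → x ≈ y
  ≈-cancelˡ z {x} {y} eq = trans (sym (+-neg z x)) (trans (≈-+ʳ (neg z) eq) (+-neg z y))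

  ≈-cancelʳ : ∀ z {x y} → x + z ≈ y + z → x ≈ y
  ≈-cancelʳ z {x} {y} eq = ≈-cancelˡ z (trans (cong (_% a) (+-comm z x)) (trans eq (cong (_% a) (+-comm y z))))

  neg-injective : ∀ {p q} → neg p ≈ neg q → p ≈ q
  neg-injective {p} {q} eq = begin
    p % a                 ≡⟨ +-neg q p ⟨
    (q + p + neg q) % a   ≡⟨ ≈-+ˡ (q + p) (sym eq) ⟩
    (q + p + neg p) % a   ≡⟨ cong (λ t → (t + neg p) % a) (+-comm q p) ⟩
    (p + q + neg p) % a   ≡⟨ +-neg p q ⟩
    q % a                 ∎
    where open ≡-Reasoning

  neg-+ : ∀ v t → v + neg t + t ≈ v
  neg-+ v t = trans (cong (_% a) (rearrange v (neg t) t)) (+-neg t v)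
    where
    rearrange : ∀ v n t → v + n + t ≡ t + v + n
    rearrange = solve-∀

  diff : ℕ → ℕ → ℕ
  diff u v = (v + neg u) % a

  diff-< : ∀ u v → diff u v < a
  diff-< u v = m%n<n (v + neg u) a

  diff-+ : ∀ u {t} → t < a → diff u ((u + t) % a) ≡ t
  diff-+ u {t} t<a = begin
    ((u + t) % a + neg u) % a ≡⟨ ≈-+ʳ (neg u) (%-≈ (u + t)) ⟩
    (u + t + neg u) % a       ≡⟨ +-neg u t ⟩
    t % a                     ≡⟨ m<n⇒m%n≡m t<a ⟩
    t                         ∎
    where open ≡-Reasoning

  +-diff : ∀ u v → u + diff u v ≈ v
  +-diff u v = trans (≈-+ˡ u (%-≈ (v + neg u))) (trans (cong (_% a) (+-comm u (v + neg u))) (neg-+ v u))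

  diff-diff : ∀ s {t} v → t < a → diff (diff (t + s) v + s) v ≡ t
  diff-diff s {t} v t<a = begin
    (v + neg (w + s)) % a           ≡⟨ ≈-+ʳ (neg (w + s)) v≈ ⟨
    ((w + s) + t + neg (w + s)) % a ≡⟨ +-neg (w + s) t ⟩
    t % a                           ≡⟨ m<n⇒m%n≡m t<a ⟩
    t                               ∎
    where
    open ≡-Reasoning
    w : ℕ
    w = diff (t + s) v
    rearrange : ∀ w s t → w + s + t ≡ t + s + w
    rearrange = solve-∀
    v≈ : (w + s) + t ≈ v
    v≈ = trans (cong (_% a) (rearrange w s t)) (+-diff (t + s) v)

  diff-cancelˡ : ∀ {u u'} v → diff u v ≡ diff u' v → u ≈ u'
  diff-cancelˡ v eq = neg-injective (≈-cancelˡ v eq)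

  diff-cancelʳ : ∀ u {v v'} → v < a → v' < a → diff u v ≡ diff u v' → v ≡ v'
  diff-cancelʳ u v<a v'<a eq = ≈⇒≡ v<a v'<a (≈-cancelʳ (neg u) eq)

module Copies (a : ℕ) where

  -- x < 2a stands for the pair (tag x, pos x) ∈ Bool × [0, a).
  pair : Bool → ℕ → ℕ
  pair false u = u
  pair true  u = a + u

  tag : ℕ → Bool
  tag x = not (x <ᵇ a)

  pos : ℕ → ℕ
  pos x = if x <ᵇ a then x else x ∸ a

  a+a≡2a : a + a ≡ 2 * a
  a+a≡2a = cong (a +_) (sym (+-identityʳ a))

  pair-< : ∀ i {u} → u < a → pair i u < 2 * a
  pair-< false u<a = <-≤-trans u<a (m≤m+n a (a + 0))
  pair-< true {u} u<a = subst (a + u <_) a+a≡2a (+-monoʳ-< a u<a)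

  tag-pair : ∀ i {u} → u < a → tag (pair i u) ≡ i
  tag-pair false u<a rewrite <⇒<ᵇ≡true u<a = refl
  tag-pair true {u} _ rewrite ≥⇒<ᵇ≡false (m≤m+n a u) = refl

  pos-pair : ∀ i {u} → u < a → pos (pair i u) ≡ u
  pos-pair false u<a rewrite <⇒<ᵇ≡true u<a = refl
  pos-pair true {u} _ rewrite ≥⇒<ᵇ≡false (m≤m+n a u) = m+n∸m≡n a u

  pair-injective : ∀ {i i' u u'} → u < a → u' < a → pair i u ≡ pair i' u' → i ≡ i' × u ≡ u'
  pair-injective {i} {i'} u<a u'<a eq =
    trans (sym (tag-pair i u<a)) (trans (cong tag eq) (tag-pair i' u'<a)) ,
    trans (sym (pos-pair i u<a)) (trans (cong pos eq) (pos-pair i' u'<a))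

  pos-< : ∀ {x} → x < 2 * a → pos x < a
  pos-< {x} x<2a with x <ᵇ a in x<?a
  ... | true  = <ᵇ≡true⇒< x<?a
  ... | false = +-cancelˡ-< a _ _ (subst₂ _<_ (sym (m+[n∸m]≡n (<ᵇ≡false⇒≥ {x} {a} x<?a))) (sym a+a≡2a) x<2a)

  pair-tag-pos : ∀ x → pair (tag x) (pos x) ≡ x
  pair-tag-pos x with x <ᵇ a in x<?a
  ... | true  = refl
  ... | false = m+[n∸m]≡n (<ᵇ≡false⇒≥ {x} {a} x<?a)

  tag-pos-injective : ∀ {x y} → tag x ≡ tag y → pos x ≡ pos y → x ≡ y
  tag-pos-injective {x} {y} tags poss = trans (sym (pair-tag-pos x)) (trans (cong₂ pair tags poss) (pair-tag-pos y))

module Twisted (a : ℕ) .{{_ : NonZero a}} (h : ℕ → ℕ → Bool) where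
  open Modular a
  open Copies a

  twisted : ℕ → ℕ → ℕ
  twisted x y = pair ((tag x xor tag y) xor h (pos x) (pos y)) ((pos x + pos y) % a)

  twisted-injective : ∀ {x y x' y'} → twisted x y ≡ twisted x' y' →
    (tag x xor tag y) xor h (pos x) (pos y) ≡ (tag x' xor tag y') xor h (pos x') (pos y') ×
    pos x + pos y ≈ pos x' + pos y'
  twisted-injective {x} {y} {x'} {y'} = pair-injective (m%n<n (pos x + pos y) a) (m%n<n (pos x' + pos y') a)

  twisted-latin : IsLatinSquare (2 * a) twisted
  twisted-latin = record
    { closed  = λ {x} {y} _ _ → pair-< ((tag x xor tag y) xor h (pos x) (pos y)) (m%n<n (pos x + pos y) a)
    ; cancelˡ = λ {x} {y} {y'} x<2a y<2a y'<2a eq →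
        let (tags , poss) = twisted-injective eq
            pos-y = ≈⇒≡ (pos-< y<2a) (pos-< y'<2a) (≈-cancelˡ (pos x) poss)
            tags′ = xor-cancelʳ _ (trans tags (cong (λ v → (tag x xor tag y') xor h (pos x) v) (sym pos-y)))
        in tag-pos-injective (xor-cancelˡ (tag x) tags′) pos-y
    ; cancelʳ = λ {y} {x} {x'} y<2a x<2a x'<2a eq →
        let (tags , poss) = twisted-injective eq
            pos-x = ≈⇒≡ (pos-< x<2a) (pos-< x'<2a) (≈-cancelʳ (pos y) poss)
            tags′ = xor-cancelʳ _ (trans tags (cong (λ u → (tag x' xor tag y) xor h u (pos y)) (sym pos-x)))
        in tag-pos-injective (xor-cancelʳ (tag y) tags′) pos-x
    }

  twisted-< : ∀ {x y} → (tag x xor tag y) xor h (pos x) (pos y) ≡ false → twisted x y < a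
  twisted-< {x} {y} eq rewrite eq = m%n<n (pos x + pos y) a

prolongation⇒LC-a²b² : ∀ {a b} .{{_ : NonZero b}} (P : Prolongation (2 * a) (2 * b)) →
  (∀ {x y} → x < 2 * a → y < 2 * a → Copies.tag a x ≡ Copies.tag a y →
     Prolongation.chosen P x y ≡ true × Prolongation.new P x y < a) →
  LC-a²b² a b
prolongation⇒LC-a²b² {a} {b} P diagonal-new =
  latinSquare⇒LC-a²b² (prolongation-latin P corner corner-latin)
    (λ x<a y<a → main-diagonal (pair-< false x<a) (pair-< false y<a)
                   (trans (tag-pair false x<a) (sym (tag-pair false y<a))))
    (λ x<a y<a → main-diagonal (pair-< true x<a) (pair-< true y<a)
                   (trans (tag-pair true x<a) (sym (tag-pair true y<a))))
    (λ {x} {y} x<b y<b → subst (_< b) (sym (square-corner x y))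
       (corner-diagonal (trans (B.tag-pair false x<b) (sym (B.tag-pair false y<b)))))
    (λ {x} {y} x<b y<b → subst (_< b) (sym (trans (cong₂ square (+-assoc (2 * a) b x) (+-assoc (2 * a) b y))
                                                  (square-corner (b + x) (b + y))))
       (corner-diagonal (trans (B.tag-pair true x<b) (sym (B.tag-pair true y<b)))))
  where
  open Prolongation P
  open Copies a
  module B = Copies b
  open Twisted b (λ _ _ → false) renaming (twisted to corner; twisted-latin to corner-latin)
  open Prolong P corner corner-latin using (square; mainCell; square-main; square-corner)

  main-diagonal : ∀ {x y} → x < 2 * a → y < 2 * a → tag x ≡ tag y → square x y < a
  main-diagonal {x} {y} x<2a y<2a tags with diagonal-new x<2a y<2a tags
  ... | is-chosen , new<a =
    subst (_< a) (sym (trans (square-main x<2a y<2a) (cong (mainCell x y) is-chosen))) new<a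

  corner-diagonal : ∀ {x y} → B.tag x ≡ B.tag y → corner x y < b
  corner-diagonal {x} {y} tags = twisted-<
    (trans (cong (λ t → (t xor B.tag y) xor false) tags) (trans (xor-identityʳ _) (xor-same (B.tag y))))

-- For a line with tag i, its c-th chosen cell lies in the block with tag
-- block i c, at offset offset i c; off the diagonal blocks only offsets < 2b − a are chosen.
record Selection (a b : ℕ) : Set where
  field
    block     : Bool → ℕ → Bool
    offset    : Bool → ℕ → ℕ
    offset-<  : ∀ i {c} → c < 2 * b → offset i c < a
    offset-<ᵉ : ∀ i {c} → c < 2 * b → i xor block i c ≡ true → offset i c < 2 * b ∸ a
    selection-injective : ∀ i {c c'} → c < 2 * b → c' < 2 * b →
                          block i c ≡ block i c' → offset i c ≡ offset i c' → c ≡ c'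

-- Prolonging the twisted square of order 2a by 2b: all cells of the diagonal blocks
-- and the cells (x, y) off them with offset δ = v − u − σ(tag x) < 2b − a are chosen;
-- the new symbol is δ, shifted by a off the diagonal blocks.
module ShiftScheme (a b : ℕ) .{{_ : NonZero a}} (a≤2b : a ≤ 2 * b)
  (σ : Bool → ℕ) (h : ℕ → ℕ → Bool) (sel : Selection a b) where
  open Modular a
  open Copies a
  open Twisted a h
  open Selection sel

  e : ℕ
  e = 2 * b ∸ a

  δ : Bool → ℕ → ℕ → ℕ
  δ i u v = diff (u + σ i) v

  chosenAt : Bool → ℕ → Bool
  chosenAt false t = true
  chosenAt true  t = t <ᵇ e

  newAt : Bool → ℕ → ℕ
  newAt false t = t
  newAt true  t = a + t

  chosen : ℕ → ℕ → Bool
  chosen x y = chosenAt (tag x xor tag y) (δ (tag x) (pos x) (pos y))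

  new : ℕ → ℕ → ℕ
  new x y = newAt (tag x xor tag y) (δ (tag x) (pos x) (pos y))

  column : ℕ → ℕ → ℕ
  column x c = pair (block (tag x) c) ((pos x + σ (tag x) + offset (tag x) c) % a)

  rowPos : Bool → ℕ → ℕ → ℕ
  rowPos j v r = diff (offset j r + σ (block j r)) v

  row : ℕ → ℕ → ℕ
  row y r = pair (block (tag y) r) (rowPos (tag y) (pos y) r)

  a+e≡2b : a + e ≡ 2 * b
  a+e≡2b = m+[n∸m]≡n a≤2b

  newAt-< : ∀ s {t} → t < a → chosenAt s t ≡ true → newAt s t < 2 * b
  newAt-< false t<a _ = <-≤-trans t<a a≤2b
  newAt-< true {t} _ t<e = subst (a + t <_) a+e≡2b (+-monoʳ-< a (<ᵇ≡true⇒< t<e))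

  newAt-injective : ∀ {s s' t t'} → t < a → t' < a → newAt s t ≡ newAt s' t' → s ≡ s' × t ≡ t'
  newAt-injective {false} {false} _ _ eq = refl , eq
  newAt-injective {true}  {true}  _ _ eq = refl , +-cancelˡ-≡ a _ _ eq
  newAt-injective {false} {true}  t<a _ eq = ⊥-elim (<⇒≱ t<a (subst (a ≤_) (sym eq) (m≤m+n a _)))
  newAt-injective {true}  {false} _ t'<a eq = ⊥-elim (<⇒≱ t'<a (subst (a ≤_) eq (m≤m+n a _)))

  new-injective : ∀ {x y x' y'} → new x y ≡ new x' y' →
    tag x xor tag y ≡ tag x' xor tag y' × δ (tag x) (pos x) (pos y) ≡ δ (tag x') (pos x') (pos y')
  new-injective {x} {y} {x'} {y'} = newAt-injective (diff-< _ _) (diff-< _ _)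

  chosenAt-selected : ∀ i {c} → c < 2 * b → chosenAt (i xor block i c) (offset i c) ≡ true
  chosenAt-selected i {c} c<2b with i xor block i c in different
  ... | false = refl
  ... | true  = <⇒<ᵇ≡true (offset-<ᵉ i c<2b different)

  tag-column : ∀ x c → tag (column x c) ≡ block (tag x) c
  tag-column x c = tag-pair (block (tag x) c) (m%n<n _ a)

  pos-column : ∀ x c → pos (column x c) ≡ (pos x + σ (tag x) + offset (tag x) c) % a
  pos-column x c = pos-pair (block (tag x) c) (m%n<n _ a)

  tag-row : ∀ y r → tag (row y r) ≡ block (tag y) r
  tag-row y r = tag-pair (block (tag y) r) (diff-< _ _)

  pos-row : ∀ y r → pos (row y r) ≡ rowPos (tag y) (pos y) r
  pos-row y r = pos-pair (block (tag y) r) (diff-< _ _)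

  column-displaced : ∀ x c → twisted x (column x c) ≡
    pair ((tag x xor block (tag x) c) xor h (pos x) ((pos x + σ (tag x) + offset (tag x) c) % a))
         ((pos x + (pos x + σ (tag x) + offset (tag x) c) % a) % a)
  column-displaced x c rewrite tag-column x c | pos-column x c = refl

  row-displaced : ∀ y r → twisted (row y r) y ≡
    pair ((block (tag y) r xor tag y) xor h (rowPos (tag y) (pos y) r) (pos y))
         ((rowPos (tag y) (pos y) r + pos y) % a)
  row-displaced y r rewrite tag-row y r | pos-row y r = refl

  new-cancelˡ : ∀ {x y y'} → y < 2 * a → y' < 2 * a → new x y ≡ new x y' → y ≡ y'
  new-cancelˡ {x} y<2a y'<2a eq =
    let (tags , offsets) = new-injective eq
    in tag-pos-injective (xor-cancelˡ (tag x) tags) (diff-cancelʳ _ (pos-< y<2a) (pos-< y'<2a) offsets)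

  new-cancelʳ : ∀ {y x x'} → x < 2 * a → x' < 2 * a → new x y ≡ new x' y → x ≡ x'
  new-cancelʳ {y} {x} {x'} x<2a x'<2a eq =
    let (tags , offsets) = new-injective eq
        tag-x = xor-cancelʳ (tag y) tags
        offsets′ = trans offsets (cong (λ i → δ i (pos x') (pos y)) (sym tag-x))
    in tag-pos-injective tag-x
         (≈⇒≡ (pos-< x<2a) (pos-< x'<2a) (≈-cancelʳ (σ (tag x)) (diff-cancelˡ (pos y) offsets′)))

  column-< : ∀ x c → column x c < 2 * a
  column-< x c = pair-< (block (tag x) c) (m%n<n _ a)

  column-chosen : ∀ x {c} → c < 2 * b → chosen x (column x c) ≡ true
  column-chosen x {c} c<2b =
    subst₂ (λ j v → chosenAt (tag x xor j) (δ (tag x) (pos x) v) ≡ true)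
      (sym (tag-column x c)) (sym (pos-column x c))
      (subst (λ t → chosenAt (tag x xor block (tag x) c) t ≡ true)
        (sym (diff-+ (pos x + σ (tag x)) (offset-< (tag x) c<2b))) (chosenAt-selected (tag x) c<2b))

  column-injective : ∀ x {c c'} → c < 2 * b → c' < 2 * b → column x c ≡ column x c' → c ≡ c'
  column-injective x {c} {c'} c<2b c'<2b eq =
    let (blocks , poss) = pair-injective {block (tag x) c} {block (tag x) c'} (m%n<n _ a) (m%n<n _ a) eq
    in selection-injective (tag x) c<2b c'<2b blocks
         (≈⇒≡ (offset-< (tag x) c<2b) (offset-< (tag x) c'<2b) (≈-cancelˡ (pos x + σ (tag x)) poss))

  row-< : ∀ y r → row y r < 2 * a
  row-< y r = pair-< (block (tag y) r) (diff-< _ _)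

  row-chosen : ∀ y {r} → r < 2 * b → chosen (row y r) y ≡ true
  row-chosen y {r} r<2b =
    subst₂ (λ j w → chosenAt (j xor tag y) (δ j w (pos y)) ≡ true)
      (sym (tag-row y r)) (sym (pos-row y r))
      (subst₂ (λ s t → chosenAt s t ≡ true) (xor-comm (tag y) (block (tag y) r))
        (sym (diff-diff (σ (block (tag y) r)) (pos y) (offset-< (tag y) r<2b))) (chosenAt-selected (tag y) r<2b))

  row-injective : ∀ y {r r'} → r < 2 * b → r' < 2 * b → row y r ≡ row y r' → r ≡ r'
  row-injective y {r} {r'} r<2b r'<2b eq =
    let (blocks , poss) = pair-injective {block (tag y) r} {block (tag y) r'} (diff-< _ _) (diff-< _ _) eq
        shifts = trans (diff-cancelˡ (pos y) poss) (cong (λ j → (offset (tag y) r' + σ j) % a) (sym blocks))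
    in selection-injective (tag y) r<2b r'<2b blocks
         (≈⇒≡ (offset-< (tag y) r<2b) (offset-< (tag y) r'<2b) (≈-cancelʳ (σ (block (tag y) r)) shifts))

  prolongation : (∀ {c x x'} → c < 2 * b → x < 2 * a → x' < 2 * a →
                    twisted x (column x c) ≡ twisted x' (column x' c) → x ≡ x') →
                 (∀ {r y y'} → r < 2 * b → y < 2 * a → y' < 2 * a →
                    twisted (row y r) y ≡ twisted (row y' r) y' → y ≡ y') →
                 Prolongation (2 * a) (2 * b)
  prolongation column-transversal row-transversal = record
    { base = twisted ; base-latin = twisted-latin
    ; chosen = chosen ; new = new
    ; new-< = λ {x} {y} _ _ → newAt-< (tag x xor tag y) (diff-< _ _)
    ; new-cancelˡ = λ _ y<2a y'<2a _ _ → new-cancelˡ y<2a y'<2a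
    ; new-cancelʳ = λ _ x<2a x'<2a _ _ → new-cancelʳ x<2a x'<2a
    ; column = column ; column-< = λ {x} {c} _ _ → column-< x c
    ; column-chosen = λ {x} _ → column-chosen x
    ; column-injective = λ {x} _ → column-injective x
    ; column-transversal = column-transversal
    ; row = row ; row-< = λ {y} {r} _ _ → row-< y r
    ; row-chosen = λ {y} _ → row-chosen y
    ; row-injective = λ {y} _ → row-injective y
    ; row-transversal = row-transversal
    }

  diagonal-new : ∀ {x y} → tag x ≡ tag y → chosen x y ≡ true × new x y < a
  diagonal-new {x} {y} tags rewrite tags | xor-same (tag y) = refl , diff-< _ _

blockOf : Bool → Bool → Bool
blockOf true  i = i
blockOf false i = not i

xor-blockOf : ∀ s i → i xor blockOf s i ≡ not s
xor-blockOf true  i = xor-same i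
xor-blockOf false i = xor-inverseʳ i

blockOf-injective : ∀ i {s s'} → blockOf s i ≡ blockOf s' i → s ≡ s'
blockOf-injective i {s} {s'} eq = not-injective (trans (sym (xor-blockOf s i)) (trans (cong (i xor_) eq) (xor-blockOf s' i)))

blockOf-injectiveʳ : ∀ s {i i'} → blockOf s i ≡ blockOf s i' → i ≡ i'
blockOf-injectiveʳ true  eq = eq
blockOf-injectiveʳ false eq = not-injective eq

module OddSelection (a b : ℕ) (b≤a : b ≤ a) (a≤2b : a ≤ 2 * b) where
  open Copies b

  d e : ℕ
  d = a ∸ b
  e = 2 * b ∸ a

  b+d≡a : b + d ≡ a
  b+d≡a = m+[n∸m]≡n b≤a

  d≤b : d ≤ b
  d≤b = +-cancelˡ-≤ b _ _ (subst₂ _≤_ (sym b+d≡a) (cong (b +_) (+-identityʳ b)) a≤2b)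

  e+d≡b : e + d ≡ b
  e+d≡b = begin
    2 * b ∸ a + d         ≡⟨ cong (λ t → 2 * b ∸ t + d) (sym b+d≡a) ⟩
    2 * b ∸ (b + d) + d   ≡⟨ cong (λ t → t ∸ (b + d) + d) (cong (b +_) (+-identityʳ b)) ⟩
    b + b ∸ (b + d) + d   ≡⟨ cong (_+ d) ([m+n]∸[m+o]≡n∸o b b d) ⟩
    b ∸ d + d             ≡⟨ m∸n+n≡m d≤b ⟩
    b                     ∎
    where open ≡-Reasoning

  -- A column index c < 2b is read as (tag c, pos c); for a line with tag i the
  -- displaced symbol will get the tag symbolTag i c.  Symbol tag true takes the
  -- offsets [0, b) of the same block; symbol tag false the offsets [b, a) of the
  -- same block (pos c < d) and [0, e) of the other block.
  symbolTag : Bool → ℕ → Bool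
  symbolTag i c = not (i xor tag c)

  sameBlock : Bool → Bool → Bool
  sameBlock true  _ = true
  sameBlock false q = q

  rawOffset : Bool → Bool → ℕ → ℕ
  rawOffset true  _     κ = κ
  rawOffset false true  κ = b + κ
  rawOffset false false κ = κ ∸ d

  Good : Bool → ℕ → Set
  Good q κ = κ < b × (q ≡ true → κ < d) × (q ≡ false → d ≤ κ)

  good : ∀ {c} → c < 2 * b → Good (pos c <ᵇ d) (pos c)
  good c<2b = pos-< c<2b , <ᵇ≡true⇒< , <ᵇ≡false⇒≥

  rawOffset-<ᵉ : ∀ p q κ → Good q κ → sameBlock p q ≡ false → rawOffset p q κ < e
  rawOffset-<ᵉ false false κ (κ<b , _ , d≤κ) _ =
    +-cancelʳ-< d (κ ∸ d) e (subst₂ _<_ (sym (m∸n+n≡m (d≤κ refl))) (sym e+d≡b) κ<b)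

  e≤b : e ≤ b
  e≤b = subst (e ≤_) e+d≡b (m≤m+n e d)

  rawOffset-< : ∀ p q κ → Good q κ → rawOffset p q κ < a
  rawOffset-< true  q     κ (κ<b , _) = <-≤-trans κ<b b≤a
  rawOffset-< false true  κ (_ , κ<d , _) = subst (b + κ <_) b+d≡a (+-monoʳ-< b (κ<d refl))
  rawOffset-< false false κ good = <-≤-trans (rawOffset-<ᵉ false false κ good refl) (≤-trans e≤b b≤a)

  rawOffset-injective : ∀ {p q κ p' q' κ'} → Good q κ → Good q' κ' → sameBlock p q ≡ sameBlock p' q' →
                        rawOffset p q κ ≡ rawOffset p' q' κ' → p ≡ p' × κ ≡ κ'
  rawOffset-injective {true}  {_}     {_} {true}  {_}     {_} _ _ _ eq = refl , eq
  rawOffset-injective {true}  {_}     {κ} {false} {true}  {κ'} (κ<b , _) _ _ eq = ⊥-elim (<⇒≱ κ<b (subst (b ≤_) (sym eq) (m≤m+n b κ')))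
  rawOffset-injective {false} {true}  {κ} {true}  {_}     {_} _ (κ'<b , _) _ eq = ⊥-elim (<⇒≱ κ'<b (subst (b ≤_) eq (m≤m+n b κ)))
  rawOffset-injective {false} {true}  {_} {false} {true}  {_} _ _ _ eq = refl , +-cancelˡ-≡ b _ _ eq
  rawOffset-injective {false} {false} {_} {false} {false} {_} (_ , _ , d≤κ) (_ , _ , d≤κ') _ eq =
    refl , trans (sym (m∸n+n≡m (d≤κ refl))) (trans (cong (_+ d) eq) (m∸n+n≡m (d≤κ' refl)))
  rawOffset-injective {true}  {_}     {_} {false} {false} _ _ () _
  rawOffset-injective {false} {false} {_} {true}  {_}     _ _ () _
  rawOffset-injective {false} {true}  {_} {false} {false} _ _ () _
  rawOffset-injective {false} {false} {_} {false} {true}  _ _ () _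

  block : Bool → ℕ → Bool
  block i c = blockOf (sameBlock (symbolTag i c) (pos c <ᵇ d)) i

  offset : Bool → ℕ → ℕ
  offset i c = rawOffset (symbolTag i c) (pos c <ᵇ d) (pos c)

  selection : Selection a b
  selection = record
    { block = block
    ; offset = offset
    ; offset-< = λ i {c} c<2b → rawOffset-< (symbolTag i c) _ _ (good c<2b)
    ; offset-<ᵉ = λ i {c} c<2b different → rawOffset-<ᵉ (symbolTag i c) _ _ (good c<2b)
        (not-injective (trans (sym (xor-blockOf _ i)) different))
    ; selection-injective = λ i {c} {c'} c<2b c'<2b blocks offsets →
        let (symbolTags , poss) = rawOffset-injective (good c<2b) (good c'<2b) (blockOf-injective i blocks) offsets
        in tag-pos-injective (xor-cancelˡ i (not-injective symbolTags)) poss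
    }

  -- The twist "offset < b" makes the displaced symbol's tag depend on i and c only.
  displaced-tag : ∀ i {c} → c < 2 * b → (i xor block i c) xor (offset i c <ᵇ b) ≡ symbolTag i c
  displaced-tag i {c} c<2b = tagFor (symbolTag i c) (pos c <ᵇ d) (pos c) (good c<2b)
    where
    tagFor : ∀ p q κ → Good q κ → (i xor blockOf (sameBlock p q) i) xor (rawOffset p q κ <ᵇ b) ≡ p
    tagFor true  q     κ (κ<b , _) rewrite xor-same i | <⇒<ᵇ≡true κ<b = refl
    tagFor false true  κ _ rewrite xor-same i | ≥⇒<ᵇ≡false (m≤m+n b κ) = refl
    tagFor false false κ good rewrite xor-inverseʳ i
      | <⇒<ᵇ≡true (<-≤-trans (rawOffset-<ᵉ false false κ good refl) e≤b) = refl

module OddOrder (c b : ℕ) .{{_ : NonZero b}} (b<a : b < suc (c + c)) (a≤2b : suc (c + c) ≤ 2 * b) where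
  a : ℕ
  a = suc (c + c)
  open Modular a
  open Copies a
  module B = Copies b
  open OddSelection a b (<⇒≤ b<a) a≤2b using (selection; symbolTag; displaced-tag)

  σ : Bool → ℕ
  σ _ = 0

  h : ℕ → ℕ → Bool
  h u v = diff (u + 0) v <ᵇ b

  open ShiftScheme a b a≤2b σ h selection
    using (column; row; column-displaced; row-displaced; prolongation; diagonal-new)
  open Selection selection using (block; offset; offset-<)
  open Twisted a h using (twisted)

  double-injective : ∀ {u u'} → u + u ≈ u' + u' → u ≈ u'
  double-injective {u} {u'} eq = begin
    u % a                  ≡⟨ halve u ⟨
    (suc c * (u + u)) % a   ≡⟨ ≈-*ˡ (suc c) {u + u} {u' + u'} eq ⟩
    (suc c * (u' + u')) % a ≡⟨ halve u' ⟩
    u' % a                  ∎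
    where
    open ≡-Reasoning
    expand : ∀ c w → suc c * (w + w) ≡ w + w * suc (c + c)
    expand = solve-∀
    halve : ∀ w → suc c * (w + w) ≈ w
    halve w = trans (cong (_% a) (expand c w)) (+-multiple-≈ w w)

  doubled-injective : ∀ β (t : Bool → ℕ) {x x'} → x < 2 * a → x' < 2 * a →
    pair (not (tag x xor β)) ((pos x + pos x + t (tag x)) % a) ≡ pair (not (tag x' xor β)) ((pos x' + pos x' + t (tag x')) % a) →
    x ≡ x'
  doubled-injective β t {x} {x'} x<2a x'<2a eq = tag-pos-injective tags
    (≈⇒≡ (pos-< x<2a) (pos-< x'<2a) (double-injective {pos x} {pos x'} (≈-cancelʳ (t (tag x)) {pos x + pos x} {pos x' + pos x'} poss′)))
    where
    split : not (tag x xor β) ≡ not (tag x' xor β) × pos x + pos x + t (tag x) ≈ pos x' + pos x' + t (tag x')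
    split = pair-injective {not (tag x xor β)} {not (tag x' xor β)}
              (m%n<n (pos x + pos x + t (tag x)) a) (m%n<n (pos x' + pos x' + t (tag x')) a) eq
    tags : tag x ≡ tag x'
    tags = xor-cancelʳ β (not-injective (proj₁ split))
    poss′ : pos x + pos x + t (tag x) ≈ pos x' + pos x' + t (tag x)
    poss′ = trans (proj₂ split) (cong (λ i → (pos x' + pos x' + t i) % a) (sym tags))

  column-symbol : ∀ x {ℓ} → ℓ < 2 * b →
    twisted x (column x ℓ) ≡ pair (symbolTag (tag x) ℓ) ((pos x + pos x + offset (tag x) ℓ) % a)
  column-symbol x {ℓ} ℓ<2b = trans (column-displaced x ℓ) (cong₂ pair symbol-tag symbol-pos)
    where
    u τ : ℕ
    u = pos x
    τ = offset (tag x) ℓ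
    symbol-tag : (tag x xor block (tag x) ℓ) xor h u ((u + 0 + τ) % a) ≡ symbolTag (tag x) ℓ
    symbol-tag = trans (cong (λ t → (tag x xor block (tag x) ℓ) xor (t <ᵇ b)) (diff-+ (u + 0) (offset-< (tag x) ℓ<2b)))
                       (displaced-tag (tag x) ℓ<2b)
    rearrange : ∀ u t → u + (u + 0 + t) ≡ u + u + t
    rearrange = solve-∀
    symbol-pos : (u + (u + 0 + τ) % a) % a ≡ (u + u + τ) % a
    symbol-pos = trans (≈-+ˡ u {(u + 0 + τ) % a} {u + 0 + τ} (%-≈ (u + 0 + τ))) (cong (_% a) (rearrange u τ))

  row-symbol : ∀ y {r} → r < 2 * b →
    twisted (row y r) y ≡ pair (symbolTag (tag y) r) ((pos y + pos y + neg (offset (tag y) r + 0)) % a)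
  row-symbol y {r} r<2b = trans (row-displaced y r) (cong₂ pair symbol-tag symbol-pos)
    where
    v τ w : ℕ
    v = pos y
    τ = offset (tag y) r
    w = diff (τ + 0) v
    symbol-tag : (block (tag y) r xor tag y) xor h w v ≡ symbolTag (tag y) r
    symbol-tag = trans (cong₂ (λ s t → s xor (t <ᵇ b)) (xor-comm (block (tag y) r) (tag y)) (diff-diff 0 v (offset-< (tag y) r<2b)))
                       (displaced-tag (tag y) r<2b)
    rearrange : ∀ v n → v + n + v ≡ v + v + n
    rearrange = solve-∀
    symbol-pos : (w + v) % a ≡ (v + v + neg (τ + 0)) % a
    symbol-pos = trans (≈-+ʳ v {w} {v + neg (τ + 0)} (%-≈ (v + neg (τ + 0)))) (cong (_% a) (rearrange v (neg (τ + 0))))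

  lc : LC-a²b² a b
  lc = prolongation⇒LC-a²b² (prolongation column-transversal row-transversal) (λ {x} {y} _ _ → diagonal-new {x} {y})
    where
    column-transversal : ∀ {ℓ x x'} → ℓ < 2 * b → x < 2 * a → x' < 2 * a →
                         twisted x (column x ℓ) ≡ twisted x' (column x' ℓ) → x ≡ x'
    column-transversal {ℓ} {x} {x'} ℓ<2b x<2a x'<2a eq = doubled-injective (B.tag ℓ) (λ i → offset i ℓ) x<2a x'<2a
      (trans (sym (column-symbol x ℓ<2b)) (trans eq (column-symbol x' ℓ<2b)))
    row-transversal : ∀ {r y y'} → r < 2 * b → y < 2 * a → y' < 2 * a →
                      twisted (row y r) y ≡ twisted (row y' r) y' → y ≡ y'
    row-transversal {r} {y} {y'} r<2b y<2a y'<2a eq = doubled-injective (B.tag r) (λ j → neg (offset j r + 0)) y<2a y'<2a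
      (trans (sym (row-symbol y r<2b)) (trans eq (row-symbol y' r<2b)))

bit : Bool → ℕ
bit false = 0
bit true  = 1

bit-injective : ∀ {p q} → bit p ≡ bit q → p ≡ q
bit-injective {false} {false} _ = refl
bit-injective {true}  {true}  _ = refl

bit-< : ∀ p → bit p < 2
bit-< false = s≤s z≤n
bit-< true  = s≤s (s≤s z≤n)

parity-injective : ∀ {m m' p p'} → m + m + bit p ≡ m' + m' + bit p' → m ≡ m' × p ≡ p'
parity-injective {m} {m'} {p} {p'} eq = *-cancelˡ-≡ m m' 2 (trans (double m) (trans m+m≡ (sym (double m')))) , p≡p'
  where
  rearrange : ∀ m q → m + m + q ≡ q + m * 2
  rearrange = solve-∀
  double : ∀ m → 2 * m ≡ m + m
  double = solve-∀
  bit-% : ∀ m p → (m + m + bit p) % 2 ≡ bit p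
  bit-% m p = trans (cong (_% 2) (rearrange m (bit p))) (trans ([m+kn]%n≡m%n (bit p) m 2) (m<n⇒m%n≡m (bit-< p)))
  p≡p' : p ≡ p'
  p≡p' = bit-injective (trans (sym (bit-% m p)) (trans (cong (_% 2) eq) (bit-% m' p')))
  m+m≡ : m + m ≡ m' + m'
  m+m≡ = +-cancelʳ-≡ (bit p) (m + m) (m' + m') (trans eq (cong (λ q → m' + m' + bit q) (sym p≡p')))

module EvenOrder (c b : ℕ) .{{_ : NonZero b}} (b<a : b < c + c) (a≤2b : c + c ≤ 2 * b) where
  a : ℕ
  a = c + c

  instance
    a-nonZero : NonZero a
    a-nonZero = >-nonZero (<-trans (>-nonZero⁻¹ b) b<a)

  open Modular a
  open Copies a

  fold : ℕ → ℕ
  fold u = if u <ᵇ c then u else u ∸ c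

  fold-< : ∀ {u} → u < a → fold u < c
  fold-< {u} u<a with u <ᵇ c in u<?c
  ... | true  = <ᵇ≡true⇒< u<?c
  ... | false = +-cancelˡ-< c _ _ (subst (_< c + c) (sym (m+[n∸m]≡n (<ᵇ≡false⇒≥ {u} {c} u<?c))) u<a)

  fold-≈ : ∀ u p → u + u + bit p ≈ fold u + fold u + bit p
  fold-≈ u p with u <ᵇ c in u<?c
  ... | true  = refl
  ... | false = begin
    (u + u + bit p) % a                                  ≡⟨ cong (λ t → (t + t + bit p) % a) (m+[n∸m]≡n (<ᵇ≡false⇒≥ {u} {c} u<?c)) ⟨
    (c + (u ∸ c) + (c + (u ∸ c)) + bit p) % a            ≡⟨ cong (_% a) (rearrange c (u ∸ c) (bit p)) ⟩
    ((u ∸ c) + (u ∸ c) + bit p + 1 * a) % a              ≡⟨ +-multiple-≈ ((u ∸ c) + (u ∸ c) + bit p) 1 ⟩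
    ((u ∸ c) + (u ∸ c) + bit p) % a                      ∎
    where
    open ≡-Reasoning
    rearrange : ∀ c w q → c + w + (c + w) + q ≡ w + w + q + 1 * (c + c)
    rearrange = solve-∀

  fold-injective : ∀ {u u'} → (u <ᵇ c) ≡ (u' <ᵇ c) → fold u ≡ fold u' → u ≡ u'
  fold-injective {u} {u'} halves eq with u <ᵇ c in u<?c | u' <ᵇ c in u'<?c
  ... | true  | true  = eq
  ... | false | false = trans (sym (m+[n∸m]≡n (<ᵇ≡false⇒≥ {u} {c} u<?c)))
                          (trans (cong (c +_) eq) (m+[n∸m]≡n (<ᵇ≡false⇒≥ {u'} {c} u'<?c)))

  doubled-< : ∀ {w} p → w < c → w + w + bit p < a
  doubled-< {w} p w<c = subst (_< a) (sym (+-assoc w w (bit p)))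
    (+-mono-<-≤ w<c (≤-trans (+-monoʳ-≤ w (<⇒≤pred (bit-< p))) (≤-trans (≤-reflexive (+-comm w 1)) w<c)))

  even-key : ∀ {u u' p p'} → u < a → u' < a → (u <ᵇ c) ≡ (u' <ᵇ c) →
             u + u + bit p ≈ u' + u' + bit p' → u ≡ u' × p ≡ p'
  even-key {u} {u'} {p} {p'} u<a u'<a halves eq =
    let (folds , bits) = parity-injective (≈⇒≡ (doubled-< p (fold-< u<a)) (doubled-< p' (fold-< u'<a))
                            (trans (sym (fold-≈ u p)) (trans eq (fold-≈ u' p'))))
    in fold-injective halves folds , bits

  e : ℕ
  e = 2 * b ∸ a

  a+e≡2b : a + e ≡ 2 * b
  a+e≡2b = m+[n∸m]≡n a≤2b

  e<a : e < a
  e<a = +-cancelˡ-< a e a (subst (_< a + a) (sym a+e≡2b)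
          (subst (_< a + a) (cong (b +_) (sym (+-identityʳ b))) (+-mono-< b<a b<a)))

  -- Border index ℓ < 2b selects offset ℓ in the same block if ℓ < a, and
  -- offset ℓ − a < e in the other block otherwise.
  unfold : Bool → ℕ → ℕ
  unfold true  ℓ = ℓ
  unfold false ℓ = ℓ ∸ a

  unfold-<ᵉ : ∀ {ℓ} → ℓ < 2 * b → (ℓ <ᵇ a) ≡ false → unfold (ℓ <ᵇ a) ℓ < e
  unfold-<ᵉ {ℓ} ℓ<2b ℓ≮a rewrite ℓ≮a =
    +-cancelˡ-< a _ _ (subst₂ _<_ (sym (m+[n∸m]≡n (<ᵇ≡false⇒≥ {ℓ} {a} ℓ≮a))) (sym a+e≡2b) ℓ<2b)

  unfold-< : ∀ {ℓ} → ℓ < 2 * b → unfold (ℓ <ᵇ a) ℓ < a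
  unfold-< {ℓ} ℓ<2b with ℓ <ᵇ a in ℓ<?a
  ... | true  = <ᵇ≡true⇒< ℓ<?a
  ... | false = <-trans (subst (λ s → unfold s ℓ < e) ℓ<?a (unfold-<ᵉ ℓ<2b ℓ<?a)) e<a

  unfold-injective : ∀ {ℓ ℓ'} → (ℓ <ᵇ a) ≡ (ℓ' <ᵇ a) → unfold (ℓ <ᵇ a) ℓ ≡ unfold (ℓ' <ᵇ a) ℓ' → ℓ ≡ ℓ'
  unfold-injective {ℓ} {ℓ'} sides eq with ℓ <ᵇ a in ℓ<?a | ℓ' <ᵇ a in ℓ'<?a
  ... | true  | true  = eq
  ... | false | false = trans (sym (m+[n∸m]≡n (<ᵇ≡false⇒≥ {ℓ} {a} ℓ<?a)))
                          (trans (cong (a +_) eq) (m+[n∸m]≡n (<ᵇ≡false⇒≥ {ℓ'} {a} ℓ'<?a)))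

  selection : Selection a b
  selection = record
    { block = λ i ℓ → blockOf (ℓ <ᵇ a) i
    ; offset = λ _ ℓ → unfold (ℓ <ᵇ a) ℓ
    ; offset-< = λ _ → unfold-<
    ; offset-<ᵉ = λ i {ℓ} ℓ<2b different →
        unfold-<ᵉ ℓ<2b (not-injective (trans (sym (xor-blockOf (ℓ <ᵇ a) i)) different))
    ; selection-injective = λ i _ _ blocks → unfold-injective (blockOf-injective i blocks)
    }

  h : ℕ → ℕ → Bool
  h u _ = u <ᵇ c

  open ShiftScheme a b a≤2b bit h selection
    using (column; row; rowPos; column-displaced; row-displaced; prolongation; diagonal-new)
  open Twisted a h using (twisted)

  doubled-injective : ∀ s t {u u' p p'} → u < a → u' < a →
    pair (not s xor (u <ᵇ c)) ((u + u + bit p + t) % a) ≡ pair (not s xor (u' <ᵇ c)) ((u' + u' + bit p' + t) % a) →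
    u ≡ u' × p ≡ p'
  doubled-injective s t {u} {u'} {p} {p'} u<a u'<a eq =
    even-key u<a u'<a (xor-cancelˡ (not s) (proj₁ split)) (≈-cancelʳ t {u + u + bit p} {u' + u' + bit p'} (proj₂ split))
    where
    split : not s xor (u <ᵇ c) ≡ not s xor (u' <ᵇ c) × u + u + bit p + t ≈ u' + u' + bit p' + t
    split = pair-injective {not s xor (u <ᵇ c)} {not s xor (u' <ᵇ c)}
              (m%n<n (u + u + bit p + t) a) (m%n<n (u' + u' + bit p' + t) a) eq

  column-symbol : ∀ x ℓ → twisted x (column x ℓ) ≡
    pair (not (ℓ <ᵇ a) xor (pos x <ᵇ c)) ((pos x + pos x + bit (tag x) + unfold (ℓ <ᵇ a) ℓ) % a)
  column-symbol x ℓ = trans (column-displaced x ℓ) (cong₂ pair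
    (cong (_xor (u <ᵇ c)) (xor-blockOf (ℓ <ᵇ a) (tag x)))
    (trans (≈-+ˡ u {(u + bit (tag x) + τ) % a} {u + bit (tag x) + τ} (%-≈ (u + bit (tag x) + τ)))
           (cong (_% a) (rearrange u (bit (tag x)) τ))))
    where
    u τ : ℕ
    u = pos x
    τ = unfold (ℓ <ᵇ a) ℓ
    rearrange : ∀ u p t → u + (u + p + t) ≡ u + u + p + t
    rearrange = solve-∀

  row-symbol : ∀ y ℓ → let ρ = blockOf (ℓ <ᵇ a) (tag y); w = rowPos (tag y) (pos y) ℓ in
    twisted (row y ℓ) y ≡ pair (not (ℓ <ᵇ a) xor (w <ᵇ c)) ((w + w + bit ρ + unfold (ℓ <ᵇ a) ℓ) % a)
  row-symbol y ℓ = trans (row-displaced y ℓ) (cong₂ pair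
    (cong (_xor (w <ᵇ c)) (trans (xor-comm ρ (tag y)) (xor-blockOf (ℓ <ᵇ a) (tag y))))
    (trans (≈-+ˡ w {pos y} {τ + bit ρ + w} (sym (+-diff (τ + bit ρ) (pos y))))
           (cong (_% a) (rearrange w (bit ρ) τ))))
    where
    ρ : Bool
    ρ = blockOf (ℓ <ᵇ a) (tag y)
    τ w : ℕ
    τ = unfold (ℓ <ᵇ a) ℓ
    w = rowPos (tag y) (pos y) ℓ
    rearrange : ∀ w p t → w + (t + p + w) ≡ w + w + p + t
    rearrange = solve-∀

  lc : LC-a²b² a b
  lc = prolongation⇒LC-a²b² (prolongation column-transversal row-transversal) (λ {x} {y} _ _ → diagonal-new {x} {y})
    where
    column-transversal : ∀ {ℓ x x'} → ℓ < 2 * b → x < 2 * a → x' < 2 * a →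
                         twisted x (column x ℓ) ≡ twisted x' (column x' ℓ) → x ≡ x'
    column-transversal {ℓ} {x} {x'} _ x<2a x'<2a eq =
      let (poss , tags) = doubled-injective (ℓ <ᵇ a) (unfold (ℓ <ᵇ a) ℓ) (pos-< x<2a) (pos-< x'<2a)
                            (trans (sym (column-symbol x ℓ)) (trans eq (column-symbol x' ℓ)))
      in tag-pos-injective tags poss
    row-transversal : ∀ {ℓ y y'} → ℓ < 2 * b → y < 2 * a → y' < 2 * a →
                      twisted (row y ℓ) y ≡ twisted (row y' ℓ) y' → y ≡ y'
    row-transversal {ℓ} {y} {y'} _ y<2a y'<2a eq =
      let (ws , blocks) = doubled-injective (ℓ <ᵇ a) τ (diff-< _ (pos y)) (diff-< _ (pos y'))
                             (trans (sym (row-symbol y ℓ)) (trans eq (row-symbol y' ℓ)))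
      in tag-pos-injective (blockOf-injectiveʳ (ℓ <ᵇ a) blocks)
           (≈⇒≡ (pos-< y<2a) (pos-< y'<2a) (begin
              pos y % a                                             ≡⟨ +-diff (τ + bit (ρ y)) (pos y) ⟨
              (τ + bit (ρ y) + rowPos (tag y) (pos y) ℓ) % a         ≡⟨ cong₂ (λ p w → (τ + bit p + w) % a) blocks ws ⟩
              (τ + bit (ρ y') + rowPos (tag y') (pos y') ℓ) % a      ≡⟨ +-diff (τ + bit (ρ y')) (pos y') ⟩
              pos y' % a                                            ∎))
      where
      open ≡-Reasoning
      τ : ℕ
      τ = unfold (ℓ <ᵇ a) ℓ
      ρ : ℕ → Bool
      ρ z = blockOf (ℓ <ᵇ a) (tag z)

parity : ∀ n → (∃[ c ] n ≡ c + c) ⊎ (∃[ c ] n ≡ suc (c + c))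
parity zero = inj₁ (0 , refl)
parity (suc n) with parity n
... | inj₁ (c , refl) = inj₂ (c , refl)
... | inj₂ (c , refl) = inj₁ (suc c , cong suc (sym (+-suc c c)))

lemma17 : (a b : ℕ) → 0 < b → b < a → a ≤ 2 * b → LC-a²b² a b
lemma17 a b 0<b b<a a≤2b with parity a
... | inj₁ (c , refl) = EvenOrder.lc c b {{>-nonZero 0<b}} b<a a≤2b
... | inj₂ (c , refl) = OddOrder.lc c b {{>-nonZero 0<b}} b<a a≤2b
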